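{- Let $G$ be a digraph on $n$ vertices and let $\delta = \delta^+(G)/n$. Suppose that $X \subseteq V(G)$ is weakly connected in $G$ and $\mathcal{K}_{3,1}(G[X]) \neq \emptyset$. Let $x \in X$ be such that $d^-(x) > (2 - \delta) n - |X|$. Then $N^+(x) \cup X$ is weakly connected in $G$.
   Context: A digraph has no loops and at most one arc from $x$ to $y$ for each ordered pair $(x,y)$ (arcs in both directions are allowed). $N^+(v)$, $N^-(v)$ are the out- and in-neighbourhoods, $d^+(v)$, $d^-(v)$ their sizes, and $\delta^+(G)$ the minimum out-degree. The base graph of a digraph is the undirected graph with an edge $xy$ whenever $xy$ or $yx$ is an arc. $\mathcal{K}_{3,1}(G)$ is the set of subdigraphs of $G$ on $3$ vertices whose base graph is a triangle and whose minimum out-degree (within the subdigraph) is at least $1$; for a 3-set $S$ we write $G[S] \in \mathcal{K}_{3,1}(G)$ if the induced subdigraph has this property. Two vertices $x,x'$ are weakly $s$-connected if there is a vertex multiset $W$ with $|W| = 3s-1$ such that each of the multisets $\{x\} \cup W$ and $\{x'\} \cup W$ can be partitioned into $S_1,\dots,S_s$ where each $S_i$ consists of three distinct vertices with $G[S_i] \in \mathcal{K}_{3,1}(G)$. A set $U \subseteq V(G)$ is weakly $s$-connected in $G$ if every pair of vertices of $U$ is weakly $s$-connected, and weakly connected if it is weakly $s$-connected for some $s \in \mathbb{N}$. -}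

module Defs where

open import Data.Bool using (Bool; true; false; _∨_; T)
open import Data.Nat using (ℕ; zero; suc; _+_; _*_; _∸_; _⊓_; _<_)
open import Data.Fin using (Fin)
open import Data.Fin.Subset using (Subset; _∈_; _∪_; ∣_∣)
open import Data.Vec using (tabulate)
open import Data.List using (List; []; _∷_; length; map; foldr; concatMap)
open import Data.List.Relation.Unary.All using (All)
open import Data.List.Relation.Binary.Permutation.Propositional using (_↭_)
open import Data.Fin.Base using () renaming (zero to fzero)
open import Data.List using (allFin)
open import Data.Product using (Σ; _×_; ∃; _,_)
open import Relation.Binary.PropositionalEquality using (_≡_)
open import Relation.Nullary using (¬_)

-- A digraph on vertex set Fin n: adjacency matrix, no loops.
-- (At most one arc per ordered pair is automatic; arcs both ways allowed.)
record Digraph (n : ℕ) : Set where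
  field
    arc     : Fin n → Fin n → Bool
    loopless : ∀ v → arc v v ≡ false
open Digraph public

module _ {n : ℕ} (G : Digraph n) where

  outNbhd : Fin n → Subset n
  outNbhd v = tabulate (λ w → arc G v w)

  inNbhd : Fin n → Subset n
  inNbhd v = tabulate (λ w → arc G w v)

  outdeg : Fin n → ℕ
  outdeg v = ∣ outNbhd v ∣

  indeg : Fin n → ℕ
  indeg v = ∣ inNbhd v ∣

-- δ⁺(G), the minimum out-degree (taken to be 0 for the empty digraph)
minOutdeg : {n : ℕ} → Digraph n → ℕ
minOutdeg {zero}  G = 0
minOutdeg {suc m} G = foldr _⊓_ (outdeg G fzero) (map (outdeg G) (allFin (suc m)))

module _ {n : ℕ} (G : Digraph n) where

  baseAdj : Fin n → Fin n → Bool
  baseAdj a b = arc G a b ∨ arc G b a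

  K31 : Fin n → Fin n → Fin n → Set
  K31 a b c =
    ¬ a ≡ b × ¬ a ≡ c × ¬ b ≡ c ×
    T (baseAdj a b) × T (baseAdj a c) × T (baseAdj b c) ×
    T (arc G a b ∨ arc G a c) × T (arc G b a ∨ arc G b c) × T (arc G c a ∨ arc G c b)

  K31ᵗ : Fin n × Fin n × Fin n → Set
  K31ᵗ (a , b , c) = K31 a b c

  flatten : List (Fin n × Fin n × Fin n) → List (Fin n)
  flatten = concatMap (λ { (a , b , c) → a ∷ b ∷ c ∷ [] })

  -- the multiset L (a list up to permutation) can be partitioned into
  -- s triples S₁,…,S_s each with G[Sᵢ] ∈ K_{3,1}(G)
  Partitionable : List (Fin n) → ℕ → Set
  Partitionable L s = Σ (List (Fin n × Fin n × Fin n)) λ Ts →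
    length Ts ≡ s × All K31ᵗ Ts × L ↭ flatten Ts

  WeaklySConnected : ℕ → Fin n → Fin n → Set
  WeaklySConnected s x x' = Σ (List (Fin n)) λ W →
    length W ≡ 3 * s ∸ 1 × Partitionable (x ∷ W) s × Partitionable (x' ∷ W) s

  WeaklySConnectedSet : ℕ → Subset n → Set
  WeaklySConnectedSet s U = ∀ u v → u ∈ U → v ∈ U → WeaklySConnected s u v

  WeaklyConnectedSet : Subset n → Set
  WeaklyConnectedSet U = ∃ λ s → WeaklySConnectedSet s U

  K31InNonempty : Subset n → Set
  K31InNonempty X = Σ (Fin n) λ a → Σ (Fin n) λ b → Σ (Fin n) λ c →
    a ∈ X × b ∈ X × c ∈ X × K31 a b c

{-# OPTIONS --safe #-}

-- For y ∈ N⁺(x) the sets N⁻(x), N⁺(y) and X have total size above 2n, so they share a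
-- vertex z and x → y → z → x is a directed triangle. Take any triangle {a,b,c} ⊆ X and
-- connect a to x and c to z inside X: replacing a by x and c by z turns a partition
-- containing {x,y,z} into one containing {a,b,c}, so y is weakly connected to b, hence
-- to x. Every vertex of N⁺(x) ∪ X is thus weakly connected to x with one common
-- number of triangles (pad with copies of {a,b,c}), and any two go through x.

module Submission where

open import Defs
open import Data.Nat using (ℕ; _+_; _*_; _<_)
open import Data.Fin using (Fin)
open import Data.Fin.Subset using (Subset; _∈_; _∪_; ∣_∣)

open import Data.Bool using (Bool; T; _∨_)
open import Data.Bool.Properties using (T-≡; T-∨)
open import Data.Fin.Subset using (_∩_; Nonempty; inside; outside)
open import Data.Fin.Subset.Properties
  using (x∈p∪q⁻; x∈p∩q⁻; ∣p∣≤n; nonempty?; Empty-unique; ∣⊥∣≡0)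
open import Data.List using (List; []; _∷_; [_]; _++_; length; map; foldr)
import Data.List.Properties as List
open import Data.List.Membership.Propositional using () renaming (_∈_ to _∈ₗ_)
open import Data.List.Membership.Propositional.Properties using (∈-allFin)
open import Data.List.Relation.Unary.All using ([]; _∷_)
open import Data.List.Relation.Unary.All.Properties using (++⁺)
open import Data.List.Relation.Unary.Any using (here; there)
open import Data.List.Relation.Binary.Permutation.Propositional
  using (_↭_; prep; swap; ↭-refl; ↭-sym; ↭-trans; module PermutationReasoning)
open import Data.List.Relation.Binary.Permutation.Propositional.Properties
  using (↭-length; shifts; ++-comm; ++-assoc; ++-identityʳ; ++⁺ˡ; ++⁺ʳ) renaming (++⁺ to ↭-++⁺)
open import Data.Nat using (zero; suc; _≤_; _∸_; _⊓_)
open import Data.Nat.Properties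
open import Data.Product using (Σ; _×_; _,_)
open import Data.Sum using (inj₁; inj₂)
open import Data.Vec using ([]; _∷_; tabulate)
open import Data.Vec.Properties using (lookup∘tabulate; []=⇒lookup)
open import Function using (_∘′_)
open import Function.Bundles using (Equivalence)
open import Relation.Binary.PropositionalEquality
  using (_≡_; _≢_; refl; sym; trans; cong; subst; module ≡-Reasoning)
open import Relation.Nullary.Decidable using (decidable-stable)

∣p∣+∣q∣≡∣p∩q∣+∣p∪q∣ : ∀ {n} (p q : Subset n) → ∣ p ∣ + ∣ q ∣ ≡ ∣ p ∩ q ∣ + ∣ p ∪ q ∣
∣p∣+∣q∣≡∣p∩q∣+∣p∪q∣ []            []            = refl
∣p∣+∣q∣≡∣p∩q∣+∣p∪q∣ (outside ∷ p) (outside ∷ q) = ∣p∣+∣q∣≡∣p∩q∣+∣p∪q∣ p q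
∣p∣+∣q∣≡∣p∩q∣+∣p∪q∣ (outside ∷ p) (inside ∷ q)  = begin
  ∣ p ∣ + suc ∣ q ∣          ≡⟨ +-suc ∣ p ∣ ∣ q ∣ ⟩
  suc (∣ p ∣ + ∣ q ∣)         ≡⟨ cong suc (∣p∣+∣q∣≡∣p∩q∣+∣p∪q∣ p q) ⟩
  suc (∣ p ∩ q ∣ + ∣ p ∪ q ∣) ≡⟨ +-suc ∣ p ∩ q ∣ ∣ p ∪ q ∣ ⟨
  ∣ p ∩ q ∣ + suc ∣ p ∪ q ∣   ∎
  where open ≡-Reasoning
∣p∣+∣q∣≡∣p∩q∣+∣p∪q∣ (inside ∷ p)  (outside ∷ q) = begin
  suc (∣ p ∣ + ∣ q ∣)         ≡⟨ cong suc (∣p∣+∣q∣≡∣p∩q∣+∣p∪q∣ p q) ⟩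
  suc (∣ p ∩ q ∣ + ∣ p ∪ q ∣) ≡⟨ +-suc ∣ p ∩ q ∣ ∣ p ∪ q ∣ ⟨
  ∣ p ∩ q ∣ + suc ∣ p ∪ q ∣   ∎
  where open ≡-Reasoning
∣p∣+∣q∣≡∣p∩q∣+∣p∪q∣ (inside ∷ p)  (inside ∷ q)  = begin
  suc (∣ p ∣ + suc ∣ q ∣)         ≡⟨ cong suc (+-suc ∣ p ∣ ∣ q ∣) ⟩
  suc (suc (∣ p ∣ + ∣ q ∣))       ≡⟨ cong (suc ∘′ suc) (∣p∣+∣q∣≡∣p∩q∣+∣p∪q∣ p q) ⟩
  suc (suc (∣ p ∩ q ∣ + ∣ p ∪ q ∣)) ≡⟨ cong suc (+-suc ∣ p ∩ q ∣ ∣ p ∪ q ∣) ⟨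
  suc (∣ p ∩ q ∣ + suc ∣ p ∪ q ∣)   ∎
  where open ≡-Reasoning

∣p∣+∣q∣≤∣p∩q∣+n : ∀ {n} (p q : Subset n) → ∣ p ∣ + ∣ q ∣ ≤ ∣ p ∩ q ∣ + n
∣p∣+∣q∣≤∣p∩q∣+n p q = ≤-trans (≤-reflexive (∣p∣+∣q∣≡∣p∩q∣+∣p∪q∣ p q)) (+-monoʳ-≤ ∣ p ∩ q ∣ (∣p∣≤n (p ∪ q)))

∣p∣>0⇒Nonempty : ∀ {n} (p : Subset n) → 0 < ∣ p ∣ → Nonempty p
∣p∣>0⇒Nonempty {n} p ∣p∣>0 = decidable-stable (nonempty? p) λ empty →
  >⇒≢ ∣p∣>0 (trans (cong ∣_∣ (Empty-unique empty)) (∣⊥∣≡0 n))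

∩₃-nonempty : ∀ {n} (p q r : Subset n) → 2 * n < ∣ p ∣ + ∣ q ∣ + ∣ r ∣ → Nonempty (p ∩ q ∩ r)
∩₃-nonempty {n} p q r large = ∣p∣>0⇒Nonempty (p ∩ q ∩ r) (+-cancelʳ-< (2 * n) 0 _ (begin-strict
  2 * n                         <⟨ large ⟩
  ∣ p ∣ + ∣ q ∣ + ∣ r ∣           ≡⟨ +-assoc (∣ p ∣) (∣ q ∣) (∣ r ∣) ⟩
  ∣ p ∣ + (∣ q ∣ + ∣ r ∣)         ≤⟨ +-monoʳ-≤ (∣ p ∣) (∣p∣+∣q∣≤∣p∩q∣+n q r) ⟩
  ∣ p ∣ + (∣ q ∩ r ∣ + n)         ≡⟨ +-assoc (∣ p ∣) (∣ q ∩ r ∣) n ⟨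
  ∣ p ∣ + ∣ q ∩ r ∣ + n           ≤⟨ +-monoˡ-≤ n (∣p∣+∣q∣≤∣p∩q∣+n p (q ∩ r)) ⟩
  ∣ p ∩ q ∩ r ∣ + n + n           ≡⟨ +-assoc (∣ p ∩ q ∩ r ∣) n n ⟩
  ∣ p ∩ q ∩ r ∣ + (n + n)         ≡⟨ cong (λ m → ∣ p ∩ q ∩ r ∣ + (n + m)) (+-identityʳ n) ⟨
  ∣ p ∩ q ∩ r ∣ + 2 * n           ∎))
  where open ≤-Reasoning

∈-tabulate⇒T : ∀ {n} {f : Fin n → Bool} {i} → i ∈ tabulate f → T (f i)
∈-tabulate⇒T {f = f} {i} i∈ = Equivalence.from T-≡ (trans (sym (lookup∘tabulate f i)) ([]=⇒lookup i∈))

foldr-⊓-map-≤ : ∀ {A : Set} (f : A → ℕ) e {xs y} → y ∈ₗ xs → foldr _⊓_ e (map f xs) ≤ f y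
foldr-⊓-map-≤ f e (here refl)  = m⊓n≤m _ _
foldr-⊓-map-≤ f e (there y∈xs) = ≤-trans (m⊓n≤n _ _) (foldr-⊓-map-≤ f e y∈xs)

minOutdeg≤outdeg : ∀ {n} (G : Digraph n) v → minOutdeg G ≤ outdeg G v
minOutdeg≤outdeg {suc n} G v = foldr-⊓-map-≤ (outdeg G) _ (∈-allFin v)

module _ {n : ℕ} (G : Digraph n) where

  arc⇒≢ : ∀ {u v} → T (arc G u v) → u ≢ v
  arc⇒≢ {u} uv refl = subst T (loopless G u) uv

  directedTriangle⇒K31 : ∀ {x y z} → T (arc G x y) → T (arc G y z) → T (arc G z x) → K31 G x y z
  directedTriangle⇒K31 xy yz zx =
    arc⇒≢ xy , arc⇒≢ zx ∘′ sym , arc⇒≢ yz ,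
    ∨⁺ˡ xy , ∨⁺ʳ zx , ∨⁺ˡ yz , ∨⁺ˡ xy , ∨⁺ʳ yz , ∨⁺ˡ zx
    where
    ∨⁺ˡ : ∀ {a b} → T a → T (a ∨ b)
    ∨⁺ˡ t = Equivalence.from T-∨ (inj₁ t)
    ∨⁺ʳ : ∀ {a b} → T b → T (a ∨ b)
    ∨⁺ʳ t = Equivalence.from T-∨ (inj₂ t)

  closingVertex : ∀ (X : Subset n) x y → 2 * n < indeg G x + outdeg G y + ∣ X ∣ →
                  Σ (Fin n) λ z → z ∈ X × T (arc G y z) × T (arc G z x)
  closingVertex X x y large =
    let z , z∈ = ∩₃-nonempty (inNbhd G x) (outNbhd G y) X large
        z∈N⁻x , z∈N⁺y∩X = x∈p∩q⁻ (inNbhd G x) _ z∈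
        z∈N⁺y , z∈X = x∈p∩q⁻ (outNbhd G y) X z∈N⁺y∩X
    in z , z∈X , ∈-tabulate⇒T z∈N⁺y , ∈-tabulate⇒T z∈N⁻x

++-interchange : ∀ {A : Set} (ws xs ys zs : List A) → (ws ++ xs) ++ ys ++ zs ↭ (ws ++ ys) ++ xs ++ zs
++-interchange ws xs ys zs = begin
  (ws ++ xs) ++ ys ++ zs ≡⟨ List.++-assoc ws xs (ys ++ zs) ⟩
  ws ++ xs ++ ys ++ zs   ↭⟨ ++⁺ˡ ws (shifts xs ys) ⟩
  ws ++ ys ++ xs ++ zs   ≡⟨ List.++-assoc ws ys (xs ++ zs) ⟨
  (ws ++ ys) ++ xs ++ zs ∎
  where open PermutationReasoning

module _ {n : ℕ} (G : Digraph n) where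

  length-flatten : ∀ Ts → length (flatten G Ts) ≡ 3 * length Ts
  length-flatten []       = refl
  length-flatten (_ ∷ Ts) = trans (cong (3 +_) (length-flatten Ts)) (sym (*-suc 3 (length Ts)))

  partitionable-length : ∀ {L s} → Partitionable G L s → length L ≡ 3 * s
  partitionable-length (Ts , refl , _ , L↭) = trans (↭-length L↭) (length-flatten Ts)

  partitionable-++ : ∀ {L M s t} → Partitionable G L s → Partitionable G M t →
                     Partitionable G (L ++ M) (s + t)
  partitionable-++ (Ts , refl , Ts-K31 , L↭) (Us , refl , Us-K31 , M↭) =
    Ts ++ Us , List.length-++ Ts , ++⁺ Ts-K31 Us-K31 ,
    subst (_ ↭_) (sym (List.concatMap-++ _ Ts Us)) (↭-++⁺ L↭ M↭)

  partitionable-resp-↭ : ∀ {L M s} → L ↭ M → Partitionable G L s → Partitionable G M s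
  partitionable-resp-↭ L↭M (Ts , len , Ts-K31 , L↭) = Ts , len , Ts-K31 , ↭-trans (↭-sym L↭M) L↭

  partitionable-[] : Partitionable G [] 0
  partitionable-[] = [] , refl , [] , ↭-refl

  K31⇒partitionable : ∀ {a b c} → K31 G a b c → Partitionable G (a ∷ b ∷ c ∷ []) 1
  K31⇒partitionable abc = _ ∷ [] , refl , abc ∷ [] , ↭-refl

  -- Weak s-connectivity of x and x′ is Exchangeable s [ x ] [ x′ ]; the size of W is then forced.
  Exchangeable : ℕ → List (Fin n) → List (Fin n) → Set
  Exchangeable s L M = Σ (List (Fin n)) λ W → Partitionable G (L ++ W) s × Partitionable G (M ++ W) s

  exchangeable⇒weaklySConnected : ∀ {s u v} → Exchangeable s [ u ] [ v ] → WeaklySConnected G s u v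
  exchangeable⇒weaklySConnected (W , uW , vW) = W , cong (_∸ 1) (partitionable-length uW) , uW , vW

  weaklySConnected⇒exchangeable : ∀ {s u v} → WeaklySConnected G s u v → Exchangeable s [ u ] [ v ]
  weaklySConnected⇒exchangeable (W , _ , uW , vW) = W , uW , vW

  partitionable⇒exchangeable : ∀ {L M s} → Partitionable G L s → Partitionable G M s → Exchangeable s L M
  partitionable⇒exchangeable {L} {M} L-part M-part =
    [] , partitionable-resp-↭ (↭-sym (++-identityʳ L)) L-part
       , partitionable-resp-↭ (↭-sym (++-identityʳ M)) M-part

  exchangeable-sym : ∀ {L M s} → Exchangeable s L M → Exchangeable s M L
  exchangeable-sym (W , LW , MW) = W , MW , LW

  exchangeable-resp-↭ : ∀ {L L′ M M′ s} → L ↭ L′ → M ↭ M′ → Exchangeable s L M → Exchangeable s L′ M′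
  exchangeable-resp-↭ L↭ M↭ (W , LW , MW) =
    W , partitionable-resp-↭ (++⁺ʳ W L↭) LW , partitionable-resp-↭ (++⁺ʳ W M↭) MW

  exchangeable-++ : ∀ {L L′ M M′ s t} → Exchangeable s L M → Exchangeable t L′ M′ →
                    Exchangeable (s + t) (L ++ L′) (M ++ M′)
  exchangeable-++ {L} {L′} {M} {M′} (W , LW , MW) (W′ , L′W′ , M′W′) =
    W ++ W′ , partitionable-resp-↭ (++-interchange L W L′ W′) (partitionable-++ LW L′W′)
            , partitionable-resp-↭ (++-interchange M W M′ W′) (partitionable-++ MW M′W′)

  exchangeable-cancelʳ : ∀ {L M K s} → Exchangeable s (L ++ K) (M ++ K) → Exchangeable s L M
  exchangeable-cancelʳ {L} {M} {K} (W , LKW , MKW) =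
    K ++ W , partitionable-resp-↭ (++-assoc L K W) LKW , partitionable-resp-↭ (++-assoc M K W) MKW

  exchangeable-trans : ∀ {L M N s t} → Exchangeable s L M → Exchangeable t M N → Exchangeable (s + t) L N
  exchangeable-trans {L} {M} {N} L≈M M≈N =
    exchangeable-cancelʳ {K = M} (exchangeable-resp-↭ ↭-refl (++-comm M N) (exchangeable-++ L≈M M≈N))

  K31⇒exchangeable-[] : ∀ {a b c} → K31 G a b c → ∀ k → Exchangeable k [] []
  K31⇒exchangeable-[] abc zero    = [] , partitionable-[] , partitionable-[]
  K31⇒exchangeable-[] abc (suc k) =
    exchangeable-++ (_ , K31⇒partitionable abc , K31⇒partitionable abc) (K31⇒exchangeable-[] abc k)

  exchangeable-mono : ∀ {a b c L M s t} → K31 G a b c → s ≤ t → Exchangeable s L M → Exchangeable t L M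
  exchangeable-mono {L = L} {M} {s} {t} abc s≤t L≈M =
    subst (λ m → Exchangeable m L M) (m+[n∸m]≡n s≤t)
      (exchangeable-resp-↭ (++-identityʳ L) (++-identityʳ M)
        (exchangeable-++ L≈M (K31⇒exchangeable-[] abc (t ∸ s))))

  -- The multisets {x,y,z} + (a + W) + (c + W′) and {a,b,c} + (x + W) + (z + W′) differ only in y versus b.
  K31-exchange : ∀ {x y z a b c s t} → K31 G x y z → K31 G a b c →
                 Exchangeable s [ a ] [ x ] → Exchangeable t [ c ] [ z ] →
                 Exchangeable (1 + (s + t)) [ y ] [ b ]
  K31-exchange {x} {y} {z} {a} {b} {c} xyz abc a≈x c≈z =
    exchangeable-cancelʳ {K = x ∷ z ∷ a ∷ c ∷ []}
      (exchangeable-resp-↭ (swap x y ↭-refl) abcxz↭bxzac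
        (exchangeable-++ (partitionable⇒exchangeable (K31⇒partitionable xyz) (K31⇒partitionable abc))
                         (exchangeable-++ a≈x c≈z)))
    where
    abcxz↭bxzac : a ∷ b ∷ c ∷ x ∷ z ∷ [] ↭ b ∷ x ∷ z ∷ a ∷ c ∷ []
    abcxz↭bxzac = ↭-trans (swap a b ↭-refl) (prep b (shifts (a ∷ c ∷ []) (x ∷ z ∷ [])))

  weaklySConnectedSet-viaHub : ∀ {r U} x → (∀ u → u ∈ U → Exchangeable r [ u ] [ x ]) →
                               WeaklySConnectedSet G (r + r) U
  weaklySConnectedSet-viaHub x hub u v u∈U v∈U =
    exchangeable⇒weaklySConnected (exchangeable-trans (hub u u∈U) (exchangeable-sym (hub v v∈U)))

propositionA6 : (n : ℕ) (G : Digraph n) (X : Subset n) →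
    WeaklyConnectedSet G X →
    K31InNonempty G X →
    (x : Fin n) → x ∈ X →
    2 * n < indeg G x + minOutdeg G + ∣ X ∣ →
    WeaklyConnectedSet G (outNbhd G x ∪ X)
propositionA6 n G X (s , X-conn) (a , b , c , a∈X , b∈X , c∈X , abc) x x∈X large =
  r + r , weaklySConnectedSet-viaHub G x linkedToX
  where
  r : ℕ
  r = 1 + (s + s) + s

  withinX : ∀ {u v} → u ∈ X → v ∈ X → Exchangeable G s [ u ] [ v ]
  withinX u∈X v∈X = weaklySConnected⇒exchangeable G (X-conn _ _ u∈X v∈X)

  outNbrLinked : ∀ y → y ∈ outNbhd G x → Exchangeable G r [ y ] [ x ]
  outNbrLinked y y∈N⁺x =
    let z , z∈X , yz , zx = closingVertex G X x y
          (<-≤-trans large (+-monoˡ-≤ ∣ X ∣ (+-monoʳ-≤ (indeg G x) (minOutdeg≤outdeg G y))))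
        xyz = directedTriangle⇒K31 G (∈-tabulate⇒T y∈N⁺x) yz zx
    in exchangeable-trans G (K31-exchange G xyz abc (withinX a∈X x∈X) (withinX c∈X z∈X)) (withinX b∈X x∈X)

  linkedToX : ∀ u → u ∈ outNbhd G x ∪ X → Exchangeable G r [ u ] [ x ]
  linkedToX u u∈ with x∈p∪q⁻ (outNbhd G x) X u∈
  ... | inj₁ u∈N⁺x = outNbrLinked u u∈N⁺x
  ... | inj₂ u∈X   = exchangeable-mono G abc (m≤n+m s _) (withinX u∈X x∈X)
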